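{- For a pattern $\tau$ and integers $n,k\ge1$, let $a_{n,k}(\tau)$ be the number of cyclic permutations $\pi\in\mathfrak S_n$ whose one-line notation avoids $\delta_k=k(k-1)\cdots 21$ and whose cycle form $C(\pi)$ avoids $\tau$. Then for all $n\ge 1$ and $k\ge 1$, $a_{n,k}(312)=a_{n,k}(213)$. Consequently the generating functions $f_k(z;312)=\sum_n a_{n,k}(312)z^n$ and $f_k(z;213)=\sum_n a_{n,k}(213)z^n$ are equal.
   Context: A permutation $\pi\in\mathfrak S_n$ is cyclic if it is a single $n$-cycle. Its cycle form is $C(\pi)=(1,c_2,\dots,c_n)$ with $c_2=\pi(1)$, $c_{i+1}=\pi(c_i)$; $C(\pi)$ avoids a pattern if the sequence $1,c_2,\dots,c_n$ does. A sequence avoids $\sigma\in\mathfrak S_m$ if no length-$m$ subsequence is order-isomorphic to $\sigma$. One-line notation: $\pi_1\cdots\pi_n$ with $\pi_i=\pi(i)$. -}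

module Defs where

open import Data.Nat using (ℕ; zero; suc; _<ᵇ_; _≡ᵇ_)
open import Data.Bool using (Bool; true; false; _∧_; not; if_then_else_)
open import Data.List using (List; []; _∷_; _++_; map; concatMap; length; filterᵇ; iterate; applyUpTo; zipWith)
open import Data.Bool.ListAction using (any; and)

-- Permutations of [n] = {1,…,n} are represented in one-line notation as
-- lists π₁ … πₙ of naturals (values 1..n).

insertAll : ℕ → List ℕ → List (List ℕ)
insertAll x []       = (x ∷ []) ∷ []
insertAll x (y ∷ ys) = (x ∷ y ∷ ys) ∷ map (y ∷_) (insertAll x ys)

perms : List ℕ → List (List ℕ)
perms []       = [] ∷ []
perms (x ∷ xs) = concatMap (insertAll x) (perms xs)

oneTo : ℕ → List ℕ
oneTo n = applyUpTo suc n

Sym : ℕ → List (List ℕ)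
Sym n = perms (oneTo n)

-- π(i) for one-line notation π (1-indexed); 0 if out of range
app : List ℕ → ℕ → ℕ
app []       _             = 0
app (x ∷ xs) zero          = 0
app (x ∷ xs) (suc zero)    = x
app (x ∷ xs) (suc (suc i)) = app xs (suc i)

cycleForm : ℕ → List ℕ → List ℕ
cycleForm n π = iterate (app π) 1 n

elemᵇ : ℕ → List ℕ → Bool
elemᵇ x = any (x ≡ᵇ_)

distinctᵇ : List ℕ → Bool
distinctᵇ []       = true
distinctᵇ (x ∷ xs) = not (elemᵇ x xs) ∧ distinctᵇ xs

-- π ∈ 𝔖ₙ is cyclic (a single n-cycle) iff the orbit 1, π(1), …, π^{n-1}(1)
-- consists of n distinct elements
cyclic : ℕ → List ℕ → Bool
cyclic n π = distinctᵇ (cycleForm n π)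

subseqs : List ℕ → List (List ℕ)
subseqs []       = [] ∷ []
subseqs (x ∷ xs) = map (x ∷_) (subseqs xs) ++ subseqs xs

_==ᵇ_ : Bool → Bool → Bool
true  ==ᵇ b = b
false ==ᵇ b = not b

orderIso : List ℕ → List ℕ → Bool
orderIso []       []       = true
orderIso (x ∷ xs) (s ∷ ss) =
  and (zipWith (λ y t → ((x <ᵇ y) ==ᵇ (s <ᵇ t)) ∧ ((y <ᵇ x) ==ᵇ (t <ᵇ s))) xs ss)
  ∧ orderIso xs ss
orderIso _        _        = false

contains : List ℕ → List ℕ → Bool
contains σ w = any (λ u → orderIso u σ) (subseqs w)

avoids : List ℕ → List ℕ → Bool
avoids σ w = not (contains σ w)

δ : ℕ → List ℕ
δ zero    = []
δ (suc k) = suc k ∷ δ k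

a : ℕ → ℕ → List ℕ → ℕ
a n k τ = length (filterᵇ (λ π → cyclic n π ∧ avoids (δ k) π ∧ avoids τ (cycleForm n π)) (Sym n))

{-# OPTIONS --safe #-}

-- Inversion π ↦ π⁻¹ is an involution of 𝔖ₙ, and it maps the permutations counted by
-- a_{n,k}(312) onto those counted by a_{n,k}(213). It preserves δₖ-avoidance, because a
-- decreasing subsequence of π at positions i₁ < ⋯ < iₖ gives one of π⁻¹ at positions
-- π(iₖ) < ⋯ < π(i₁). It preserves cyclicity, and π⁻¹ runs through the cycle of π
-- backwards: if C(π) = (1, t) then C(π⁻¹) = (1, reverse t). Neither 312 nor 213 starts
-- with its smallest letter, so the leading 1 never takes part in an occurrence. Hence
-- C(π) avoids 312 iff t does, iff reverse t avoids 213, iff C(π⁻¹) avoids 213.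

module Submission where

open import Defs
open import Data.Bool using (Bool; true; false; _∧_; not; T)
open import Data.Bool.ListAction using (and)
open import Data.Bool.Properties using (T-∧; ∧-comm; ∧-zeroʳ)
open import Data.Empty using (⊥; ⊥-elim)
open import Data.List
  using (List; []; _∷_; _++_; [_]; map; length; reverse; iterate; applyUpTo; concatMap; filter; filterᵇ; zipWith)
import Data.List.Properties as List
open import Data.List.Membership.Propositional using (_∈_; _∉_; find; lose)
open import Data.List.Membership.Propositional.Properties
  using ( ∈-map⁺; ∈-map⁻; ∈-++⁺ˡ; ∈-++⁺ʳ; ∈-++⁻; ∈-∃++
        ; ∈-applyUpTo⁺; ∈-applyUpTo⁻; ∈-concatMap⁺; ∈-concatMap⁻)
open import Data.List.Relation.Unary.All as All using (All; []; _∷_)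
import Data.List.Relation.Unary.All.Properties as All
open import Data.List.Relation.Unary.Any as Any using (here; there)
open import Data.List.Relation.Unary.Any.Properties using (any⁺; any⁻)
open import Data.List.Relation.Unary.AllPairs using (AllPairs; []; _∷_)
import Data.List.Relation.Unary.AllPairs as AllPairs
import Data.List.Relation.Unary.AllPairs.Properties as AllPairs
open import Data.List.Relation.Unary.Unique.Propositional using (Unique)
import Data.List.Relation.Unary.Unique.Propositional.Properties as Unique
open import Data.List.Relation.Binary.Permutation.Propositional
  using (_↭_; ↭-refl; ↭-sym; ↭-trans; prep; swap; ↭⇒↭ₛ)
open import Data.List.Relation.Binary.Permutation.Propositional.Properties
  using (∈-resp-↭; All-resp-↭; ↭-length; ↭-reverse; shift; drop-mid; ↭-empty-inv; filter-↭)
import Data.List.Relation.Binary.Permutation.Setoid.Properties as Setoid↭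
open import Data.List.Relation.Binary.Sublist.Propositional using (_⊆_; []; _∷_; _∷ʳ_; minimum)
import Data.List.Relation.Binary.Sublist.Propositional.Properties as Sublist
open import Data.Nat using (ℕ; zero; suc; _≤_; _<_; _>_; _<ᵇ_; _≡ᵇ_; z≤n; s≤s)
import Data.Nat.GeneralisedArithmetic as ℕ
open import Data.Nat.Properties
  using ( _≟_; <ᵇ-reflects-<; <⇒<ᵇ; ≡ᵇ⇒≡; ≡⇒≡ᵇ; suc-injective; ≤-pred; ≤-reflexive; ≤-antisym; ≮⇒≥
        ; ≤⇒≯; <⇒≯; <⇒≢; <-asym; <-trans; n<1+n; m<n⇒m<1+n)
open import Data.Product using (∃-syntax; _×_; _,_; proj₁; proj₂)
open import Data.Sum using (inj₁; inj₂)
open import Function using (_∘_; flip; _⇔_; mk⇔; Equivalence)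
open import Relation.Nullary using (¬_; ¬?; yes; no)
open import Relation.Nullary.Decidable using (T?)
open import Relation.Nullary.Reflects using (ofʸ; ofⁿ)
open import Relation.Binary.PropositionalEquality hiding ([_]; J)

open Equivalence using (to; from)

T-ext : ∀ {a b} → (T a → T b) → (T b → T a) → a ≡ b
T-ext {false} {false} _ _ = refl
T-ext {false} {true}  _ g = ⊥-elim (g _)
T-ext {true}  {false} f _ = ⊥-elim (f _)
T-ext {true}  {true}  _ _ = refl

∧-congˡ-T : ∀ {a b c} → (T a → b ≡ c) → a ∧ b ≡ a ∧ c
∧-congˡ-T {false} _ = refl
∧-congˡ-T {true}  h = h _

Unique-resp-↭ : ∀ {A : Set} {xs ys : List A} → xs ↭ ys → Unique xs → Unique ys
Unique-resp-↭ {A} p = Setoid↭.Unique-resp-↭ (setoid A) (↭⇒↭ₛ p)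

Unique-map-∈ : ∀ {A B : Set} (f : A → B) {xs} →
  (∀ {x y} → x ∈ xs → y ∈ xs → f x ≡ f y → x ≡ y) → Unique xs → Unique (map f xs)
Unique-map-∈ f {[]}     _   []          = []
Unique-map-∈ f {x ∷ xs} inj (x∉xs ∷ u) =
  All.tabulate fx∉ ∷ Unique-map-∈ f (λ p q → inj (there p) (there q)) u
  where
  fx∉ : ∀ {v} → v ∈ map f xs → f x ≢ v
  fx∉ v∈ with y , y∈ , refl ← ∈-map⁻ f v∈ = All.lookup x∉xs y∈ ∘ inj (here refl) (there y∈)

∈-∷⁻ : ∀ {A : Set} {x y : A} {xs} → y ∈ x ∷ xs → x ≢ y → y ∈ xs
∈-∷⁻ (here refl) x≢x = ⊥-elim (x≢x refl)
∈-∷⁻ (there y∈)  _   = y∈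

⊆-length⇒↭ : ∀ {A : Set} {xs ys : List A} → Unique xs → Unique ys →
  (∀ {v} → v ∈ xs → v ∈ ys) → length ys ≤ length xs → xs ↭ ys
⊆-length⇒↭ {xs = []} {[]} _ _ _ _ = ↭-refl
⊆-length⇒↭ {xs = x ∷ xs} (x∉xs ∷ u) uys xs⊆ys len
  with as , bs , refl ← ∈-∃++ (xs⊆ys (here refl)) =
  ↭-trans (prep x (⊆-length⇒↭ u (AllPairs.tail (Unique-resp-↭ moveˣ uys)) xs⊆as++bs len′))
          (↭-sym moveˣ)
  where
  moveˣ = shift x as bs
  xs⊆as++bs : ∀ {v} → v ∈ xs → v ∈ as ++ bs
  xs⊆as++bs v∈ = ∈-∷⁻ (∈-resp-↭ moveˣ (xs⊆ys (there v∈))) (All.lookup x∉xs v∈)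
  len′ : length (as ++ bs) ≤ length xs
  len′ = ≤-pred (subst (_≤ suc (length xs)) (↭-length moveˣ) len)

map-involution-↭ : ∀ {A : Set} (f : A → A) {xs} → Unique xs →
  (∀ {x} → x ∈ xs → f x ∈ xs) → (∀ {x} → x ∈ xs → f (f x) ≡ x) → map f xs ↭ xs
map-involution-↭ f {xs} u closed invol =
  ⊆-length⇒↭ (Unique-map-∈ f injective u) u fxs⊆xs (≤-reflexive (sym (List.length-map f xs)))
  where
  injective : ∀ {x y} → x ∈ xs → y ∈ xs → f x ≡ f y → x ≡ y
  injective {x} {y} x∈ y∈ fx≡fy = trans (sym (invol x∈)) (trans (cong f fx≡fy) (invol y∈))
  fxs⊆xs : ∀ {v} → v ∈ map f xs → v ∈ xs
  fxs⊆xs v∈ with x , x∈ , refl ← ∈-map⁻ f v∈ = closed x∈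

length-filterᵇ-map : ∀ {A B : Set} (p : B → Bool) (f : A → B) xs →
  length (filterᵇ p (map f xs)) ≡ length (filterᵇ (p ∘ f) xs)
length-filterᵇ-map p f []       = refl
length-filterᵇ-map p f (x ∷ xs) with p (f x)
... | true  = cong suc (length-filterᵇ-map p f xs)
... | false = length-filterᵇ-map p f xs

filterᵇ-cong-∈ : ∀ {A : Set} {p q : A → Bool} xs →
  (∀ {x} → x ∈ xs → p x ≡ q x) → filterᵇ p xs ≡ filterᵇ q xs
filterᵇ-cong-∈         []       _   = refl
filterᵇ-cong-∈ {p = p} {q} (x ∷ xs) p≗q with p x | q x | p≗q (here refl)
... | true  | .true  | refl = cong (x ∷_) (filterᵇ-cong-∈ xs (p≗q ∘ there))
... | false | .false | refl = filterᵇ-cong-∈ xs (p≗q ∘ there)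

length-filterᵇ-bijection : ∀ {A : Set} (f : A → A) {p q : A → Bool} {xs} → map f xs ↭ xs →
  (∀ {x} → x ∈ xs → p x ≡ q (f x)) → length (filterᵇ p xs) ≡ length (filterᵇ q xs)
length-filterᵇ-bijection f {p} {q} {xs} fxs↭xs p≗q∘f = begin
  length (filterᵇ p xs)         ≡⟨ cong length (filterᵇ-cong-∈ xs p≗q∘f) ⟩
  length (filterᵇ (q ∘ f) xs)   ≡⟨ sym (length-filterᵇ-map q f xs) ⟩
  length (filterᵇ q (map f xs)) ≡⟨ ↭-length (filter-↭ (T? ∘ q) fxs↭xs) ⟩
  length (filterᵇ q xs)         ∎
  where open ≡-Reasoning

insertAll-↭ : ∀ x ys {v} → v ∈ insertAll x ys → v ↭ x ∷ ys
insertAll-↭ x []       (here refl) = ↭-refl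
insertAll-↭ x (y ∷ ys) (here refl) = ↭-refl
insertAll-↭ x (y ∷ ys) (there v∈) with w , w∈ , refl ← ∈-map⁻ (y ∷_) v∈ =
  ↭-trans (prep y (insertAll-↭ x ys w∈)) (swap y x ↭-refl)

∈-insertAll : ∀ x as bs → as ++ x ∷ bs ∈ insertAll x (as ++ bs)
∈-insertAll x []       []       = here refl
∈-insertAll x []       (b ∷ bs) = here refl
∈-insertAll x (a ∷ as) bs       = there (∈-map⁺ (a ∷_) (∈-insertAll x as bs))

∈-perms⁻ : ∀ xs {v} → v ∈ perms xs → v ↭ xs
∈-perms⁻ []       (here refl) = ↭-refl
∈-perms⁻ (x ∷ xs) v∈
  with w , w∈ , v∈′ ← find (∈-concatMap⁻ (insertAll x) {xs = perms xs} v∈) =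
  ↭-trans (insertAll-↭ x w v∈′) (prep x (∈-perms⁻ xs w∈))

∈-perms⁺ : ∀ xs {v} → v ↭ xs → v ∈ perms xs
∈-perms⁺ []       v↭[] rewrite ↭-empty-inv v↭[] = here refl
∈-perms⁺ (x ∷ xs) v↭x∷xs
  with as , bs , refl ← ∈-∃++ (∈-resp-↭ (↭-sym v↭x∷xs) (here refl)) =
  ∈-concatMap⁺ (insertAll x) (lose (∈-perms⁺ xs (drop-mid as [] v↭x∷xs)) (∈-insertAll x as bs))

erase : ℕ → List ℕ → List ℕ
erase x = filter (¬? ∘ (x ≟_))

erase-insertAll : ∀ {x ys v} → x ∉ ys → v ∈ insertAll x ys → erase x v ≡ ys
erase-insertAll {x} {[]}     _     (here refl) = List.filter-reject (¬? ∘ (x ≟_)) (λ x≢x → x≢x refl)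
erase-insertAll {x} {y ∷ ys} x∉ys (here refl) = begin
  erase x (x ∷ y ∷ ys) ≡⟨ List.filter-reject (¬? ∘ (x ≟_)) (λ x≢x → x≢x refl) ⟩
  erase x (y ∷ ys)     ≡⟨ List.filter-all (¬? ∘ (x ≟_)) (All.¬Any⇒All¬ (y ∷ ys) x∉ys) ⟩
  y ∷ ys               ∎
  where open ≡-Reasoning
erase-insertAll {x} {y ∷ ys} x∉ys (there v∈)
  with w , w∈ , refl ← ∈-map⁻ (y ∷_) v∈ = begin
  erase x (y ∷ w)   ≡⟨ List.filter-accept (¬? ∘ (x ≟_)) (x∉ys ∘ here) ⟩
  y ∷ erase x w     ≡⟨ cong (y ∷_) (erase-insertAll (x∉ys ∘ there) w∈) ⟩
  y ∷ ys            ∎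
  where open ≡-Reasoning

insertAll-unique : ∀ {x ys} → x ∉ ys → Unique (insertAll x ys)
insertAll-unique {x} {[]}     _    = [] ∷ []
insertAll-unique {x} {y ∷ ys} x∉ys =
  All.tabulate head≢ ∷ Unique.map⁺ ∷-injectiveʳ (insertAll-unique (x∉ys ∘ there))
  where
  ∷-injectiveʳ : ∀ {xs zs} → y ∷ xs ≡ y ∷ zs → xs ≡ zs
  ∷-injectiveʳ refl = refl
  head≢ : ∀ {v} → v ∈ map (y ∷_) (insertAll x ys) → x ∷ y ∷ ys ≢ v
  head≢ v∈ x∷y∷ys≡v with _ , _ , refl ← ∈-map⁻ (y ∷_) (subst (_∈ _) (sym x∷y∷ys≡v) v∈) =
    x∉ys (here refl)

concatMap-insertAll-unique : ∀ {x L} → Unique L → All (x ∉_) L → Unique (concatMap (insertAll x) L)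
concatMap-insertAll-unique {x} {[]}    []          []          = []
concatMap-insertAll-unique {x} {w ∷ L} (w∉L ∷ u) (x∉w ∷ x∉L) =
  Unique.++⁺ (insertAll-unique x∉w) (concatMap-insertAll-unique u x∉L) disjoint
  where
  disjoint : ∀ {v} → v ∈ insertAll x w × v ∈ concatMap (insertAll x) L → ⊥
  disjoint (v∈ , v∈′)
    with w′ , w′∈ , v∈″ ← find (∈-concatMap⁻ (insertAll x) {xs = L} v∈′) =
    All.lookup w∉L w′∈
      (trans (sym (erase-insertAll x∉w v∈)) (erase-insertAll (All.lookup x∉L w′∈) v∈″))

perms-unique : ∀ {xs} → Unique xs → Unique (perms xs)
perms-unique {[]}     []          = [] ∷ []
perms-unique {x ∷ xs} (x∉xs ∷ u) =
  concatMap-insertAll-unique (perms-unique u) (All.tabulate (x∉ ∘ ∈-perms⁻ xs))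
  where
  x∉ : ∀ {w} → w ↭ xs → x ∉ w
  x∉ w↭xs x∈w = All.All¬⇒¬Any x∉xs (∈-resp-↭ w↭xs x∈w)

Increasing Decreasing : List ℕ → Set
Increasing = AllPairs _<_
Decreasing = AllPairs _>_

InRange : ℕ → ℕ → Set
InRange n i = 1 ≤ i × i ≤ n

∈-oneTo⁻ : ∀ {n v} → v ∈ oneTo n → InRange n v
∈-oneTo⁻ v∈ with i , i<n , refl ← ∈-applyUpTo⁻ suc v∈ = s≤s z≤n , i<n

∈-oneTo⁺ : ∀ {n v} → InRange n v → v ∈ oneTo n
∈-oneTo⁺ {v = suc i} (_ , i<n) = ∈-applyUpTo⁺ suc i<n

oneTo-increasing : ∀ n → Increasing (oneTo n)
oneTo-increasing n = AllPairs.applyUpTo⁺₁ suc n (λ i<j _ → s≤s i<j)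

oneTo-unique : ∀ n → Unique (oneTo n)
oneTo-unique n = AllPairs.map <⇒≢ (oneTo-increasing n)

app-applyUpTo : ∀ (f : ℕ → ℕ) {n i} → i < n → app (applyUpTo f n) (suc i) ≡ f i
app-applyUpTo f {suc n} {zero}  _         = refl
app-applyUpTo f {suc n} {suc i} (s≤s i<n) = app-applyUpTo (f ∘ suc) i<n

applyUpTo-app : ∀ w → applyUpTo (app w ∘ suc) (length w) ≡ w
applyUpTo-app []       = refl
applyUpTo-app (x ∷ xs) = cong (x ∷_) (applyUpTo-app xs)

app-∈ : ∀ w {i} → InRange (length w) i → app w i ∈ w
app-∈ w {suc i} (_ , i<n) =
  subst (app w (suc i) ∈_) (applyUpTo-app w) (∈-applyUpTo⁺ (app w ∘ suc) i<n)

app-ext : ∀ {v w} → length v ≡ length w →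
  (∀ {i} → InRange (length v) i → app v i ≡ app w i) → v ≡ w
app-ext {[]}    {[]}    _     _    = refl
app-ext {x ∷ v} {y ∷ w} len≡ app≗ =
  cong₂ _∷_ (app≗ (s≤s z≤n , s≤s z≤n)) (app-ext (suc-injective len≡) tail≗)
  where
  tail≗ : ∀ {i} → InRange (length v) i → app v i ≡ app w i
  tail≗ {suc i} (_ , i≤n) = app≗ (s≤s z≤n , s≤s i≤n)

-- 0-based, whereas app is 1-based.
indexOf : ℕ → List ℕ → ℕ
indexOf j []       = 0
indexOf j (x ∷ xs) with j ≟ x
... | yes _ = 0
... | no  _ = suc (indexOf j xs)

indexOf-< : ∀ {j w} → j ∈ w → indexOf j w < length w
indexOf-< {j} {x ∷ xs} j∈ with j ≟ x
indexOf-< _          | yes _   = s≤s z≤n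
indexOf-< (here j≡x) | no j≢x = ⊥-elim (j≢x j≡x)
indexOf-< (there j∈) | no _    = s≤s (indexOf-< j∈)

app-indexOf : ∀ {j w} → j ∈ w → app w (suc (indexOf j w)) ≡ j
app-indexOf {j} {x ∷ xs} j∈ with j ≟ x
app-indexOf _          | yes j≡x = sym j≡x
app-indexOf (here j≡x) | no j≢x  = ⊥-elim (j≢x j≡x)
app-indexOf (there j∈) | no _     = app-indexOf j∈

indexOf-app : ∀ {w i} → Unique w → i < length w → indexOf (app w (suc i)) w ≡ i
indexOf-app {x ∷ xs} {zero} _ _ with x ≟ x
... | yes _   = refl
... | no x≢x = ⊥-elim (x≢x refl)
indexOf-app {x ∷ xs} {suc i} (x∉xs ∷ u) (s≤s i<n) with app xs (suc i) ≟ x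
... | yes w≡x = ⊥-elim (All.lookup x∉xs (app-∈ xs (s≤s z≤n , i<n)) (sym w≡x))
... | no _    = cong suc (indexOf-app u i<n)

record Inverses (n : ℕ) (π σ : List ℕ) : Set where
  field
    π-range : ∀ {i} → InRange n i → InRange n (app π i)
    σ-range : ∀ {i} → InRange n i → InRange n (app σ i)
    σ∘π     : ∀ {i} → InRange n i → app σ (app π i) ≡ i
    π∘σ     : ∀ {i} → InRange n i → app π (app σ i) ≡ i

Inverses-sym : ∀ {n π σ} → Inverses n π σ → Inverses n σ π
Inverses-sym inv = record { π-range = σ-range ; σ-range = π-range ; σ∘π = π∘σ ; π∘σ = σ∘π }
  where open Inverses inv

Inverses-unique : ∀ {n π σ σ′} → Inverses n π σ → Inverses n π σ′ →
  length σ ≡ n → length σ′ ≡ n → σ ≡ σ′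
Inverses-unique {n} {π} {σ} {σ′} inv inv′ len len′ =
  app-ext (trans len (sym len′)) (app≗ ∘ subst (λ m → InRange m _) len)
  where
  open ≡-Reasoning
  app≗ : ∀ {i} → InRange n i → app σ i ≡ app σ′ i
  app≗ {i} i∈ = begin
    app σ i                     ≡⟨ cong (app σ) (sym (Inverses.π∘σ inv′ i∈)) ⟩
    app σ (app π (app σ′ i))    ≡⟨ Inverses.σ∘π inv (Inverses.σ-range inv′ i∈) ⟩
    app σ′ i                    ∎

inverse : ℕ → List ℕ → List ℕ
inverse n π = map (λ j → suc (indexOf j π)) (oneTo n)

length-inverse : ∀ n π → length (inverse n π) ≡ n
length-inverse n π = trans (List.length-map _ (oneTo n)) (List.length-applyUpTo suc n)

app-inverse : ∀ {n} π {j} → InRange n j → app (inverse n π) j ≡ suc (indexOf j π)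
app-inverse {n} π {suc i} (_ , i<n) =
  trans (cong (λ w → app w (suc i)) (List.map-applyUpTo suc _ n)) (app-applyUpTo _ i<n)

module Permutation {n : ℕ} {π : List ℕ} (π↭ : π ↭ oneTo n) where

  length-π : length π ≡ n
  length-π = trans (↭-length π↭) (List.length-applyUpTo suc n)

  unique : Unique π
  unique = Unique-resp-↭ (↭-sym π↭) (oneTo-unique n)

  ∈⁻ : ∀ {v} → v ∈ π → InRange n v
  ∈⁻ = ∈-oneTo⁻ ∘ ∈-resp-↭ π↭

  ∈⁺ : ∀ {v} → InRange n v → v ∈ π
  ∈⁺ = ∈-resp-↭ (↭-sym π↭) ∘ ∈-oneTo⁺

  inRange-length : ∀ {i} → InRange n i → InRange (length π) i
  inRange-length = subst (λ m → InRange m _) (sym length-π)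

  indexOf-range : ∀ {j} → InRange n j → InRange n (suc (indexOf j π))
  indexOf-range j∈ = s≤s z≤n , subst (_ <_) length-π (indexOf-< (∈⁺ j∈))

  inverse-↭ : inverse n π ↭ oneTo n
  inverse-↭ =
    ⊆-length⇒↭ (Unique-map-∈ _ injective (oneTo-unique n)) (oneTo-unique n) ⊆oneTo
      (≤-reflexive (trans (List.length-applyUpTo suc n) (sym (length-inverse n π))))
    where
    injective : ∀ {a b} → a ∈ oneTo n → b ∈ oneTo n → suc (indexOf a π) ≡ suc (indexOf b π) → a ≡ b
    injective {a} {b} a∈ b∈ eq = begin
      a                           ≡⟨ sym (app-indexOf (∈⁺ (∈-oneTo⁻ a∈))) ⟩
      app π (suc (indexOf a π))   ≡⟨ cong (app π) eq ⟩
      app π (suc (indexOf b π))   ≡⟨ app-indexOf (∈⁺ (∈-oneTo⁻ b∈)) ⟩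
      b                           ∎
      where open ≡-Reasoning
    ⊆oneTo : ∀ {v} → v ∈ inverse n π → v ∈ oneTo n
    ⊆oneTo v∈ with j , j∈ , refl ← ∈-map⁻ _ v∈ =
      ∈-oneTo⁺ (indexOf-range (∈-oneTo⁻ j∈))

  inverses : Inverses n π (inverse n π)
  inverses = record
    { π-range = ∈⁻ ∘ app-∈ π ∘ inRange-length
    ; σ-range = λ i∈ → subst (InRange n) (sym (app-inverse π i∈)) (indexOf-range i∈)
    ; σ∘π = σ∘π
    ; π∘σ = λ i∈ → trans (cong (app π) (app-inverse π i∈)) (app-indexOf (∈⁺ i∈))
    }
    where
    σ∘π : ∀ {i} → InRange n i → app (inverse n π) (app π i) ≡ i
    σ∘π {suc i} i∈ = begin
      app (inverse n π) (app π (suc i))    ≡⟨ app-inverse π (∈⁻ (app-∈ π (inRange-length i∈))) ⟩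
      suc (indexOf (app π (suc i)) π)      ≡⟨ cong suc (indexOf-app unique (proj₂ (inRange-length i∈))) ⟩
      suc i                                ∎
      where open ≡-Reasoning

inverse-involutive : ∀ {n π} → π ↭ oneTo n → inverse n (inverse n π) ≡ π
inverse-involutive {n} {π} π↭ =
  Inverses-unique (Permutation.inverses (Permutation.inverse-↭ π↭)) (Inverses-sym (Permutation.inverses π↭))
    (length-inverse n (inverse n π)) (Permutation.length-π π↭)

∈-Sym⁻ : ∀ n {π} → π ∈ Sym n → π ↭ oneTo n
∈-Sym⁻ n = ∈-perms⁻ (oneTo n)

∈-Sym⁺ : ∀ n {π} → π ↭ oneTo n → π ∈ Sym n
∈-Sym⁺ n = ∈-perms⁺ (oneTo n)

map-inverse-Sym : ∀ n → map (inverse n) (Sym n) ↭ Sym n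
map-inverse-Sym n = map-involution-↭ (inverse n) (perms-unique (oneTo-unique n))
  (∈-Sym⁺ n ∘ Permutation.inverse-↭ ∘ ∈-Sym⁻ n)
  (inverse-involutive ∘ ∈-Sym⁻ n)

elemᵇ⇒∈ : ∀ {x} xs → T (elemᵇ x xs) → x ∈ xs
elemᵇ⇒∈ {x} xs = Any.map (≡ᵇ⇒≡ x _) ∘ any⁻ (x ≡ᵇ_) xs

∈⇒elemᵇ : ∀ {x xs} → x ∈ xs → T (elemᵇ x xs)
∈⇒elemᵇ {x} = any⁺ (x ≡ᵇ_) ∘ Any.map (≡⇒≡ᵇ x _)

distinctᵇ⇒Unique : ∀ xs → T (distinctᵇ xs) → Unique xs
distinctᵇ⇒Unique []       _ = []
distinctᵇ⇒Unique (x ∷ xs) h with elemᵇ x xs in x∈?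
... | false = All.¬Any⇒All¬ xs (subst T x∈? ∘ ∈⇒elemᵇ) ∷ distinctᵇ⇒Unique xs h

Unique⇒distinctᵇ : ∀ {xs} → Unique xs → T (distinctᵇ xs)
Unique⇒distinctᵇ {[]}     []          = _
Unique⇒distinctᵇ {x ∷ xs} (x∉xs ∷ u) with elemᵇ x xs in x∈?
... | true  = All.All¬⇒¬Any x∉xs (elemᵇ⇒∈ xs (subst T (sym x∈?) _))
... | false = Unique⇒distinctᵇ u

iterate-suc : ∀ (f : ℕ → ℕ) x j → ℕ.iterate f x (suc j) ≡ f (ℕ.iterate f x j)
iterate-suc f x zero    = refl
iterate-suc f x (suc j) = iterate-suc f (f x) j

iterate-++ : ∀ (f : ℕ → ℕ) x j → iterate f x (suc j) ≡ iterate f x j ++ [ ℕ.iterate f x j ]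
iterate-++ f x zero    = refl
iterate-++ f x (suc j) = cong (x ∷_) (iterate-++ f (f x) j)

∈-iterate⁻ : ∀ {f : ℕ → ℕ} {x} n {v} → v ∈ iterate f x n → ∃[ j ] j < n × v ≡ ℕ.iterate f x j
∈-iterate⁻ (suc n) (here refl) = 0 , s≤s z≤n , refl
∈-iterate⁻ (suc n) (there v∈) with j , j<n , refl ← ∈-iterate⁻ n v∈ = suc j , s≤s j<n , refl

∈-iterate⁺ : ∀ {f : ℕ → ℕ} {x n j} → j < n → ℕ.iterate f x j ∈ iterate f x n
∈-iterate⁺ {j = zero}  (s≤s _)   = here refl
∈-iterate⁺ {j = suc j} (s≤s j<n) = there (∈-iterate⁺ j<n)

module Cycle {m : ℕ} {π σ : List ℕ} (inv : Inverses (suc m) π σ) where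
  open Inverses inv

  private
    N = suc m
    f = app π
    g = app σ
    1∈ : InRange N 1
    1∈ = s≤s z≤n , s≤s z≤n

  iterate-range : ∀ j {x} → InRange N x → InRange N (ℕ.iterate f x j)
  iterate-range zero    x∈ = x∈
  iterate-range (suc j) x∈ = iterate-range j (π-range x∈)

  orbit-range : ∀ {x n v} → InRange N x → v ∈ iterate f x n → InRange N v
  orbit-range {n = n} x∈ v∈ with j , _ , refl ← ∈-iterate⁻ n v∈ = iterate-range j x∈

  iterate-inverse : ∀ j {x} → InRange N x → iterate g (ℕ.iterate f x j) j ≡ reverse (iterate f (f x) j)
  iterate-inverse zero    _  = refl
  iterate-inverse (suc j) {x} x∈ = begin
    ℕ.iterate f x (suc j) ∷ iterate g (g (ℕ.iterate f x (suc j))) j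
      ≡⟨ cong (λ y → ℕ.iterate f (f x) j ∷ iterate g y j) g∘f-step ⟩
    ℕ.iterate f (f x) j ∷ iterate g (ℕ.iterate f x j) j
      ≡⟨ cong (ℕ.iterate f (f x) j ∷_) (iterate-inverse j x∈) ⟩
    ℕ.iterate f (f x) j ∷ reverse (iterate f (f x) j)
      ≡⟨ sym (List.reverse-++ (iterate f (f x) j) [ _ ]) ⟩
    reverse (iterate f (f x) j ++ [ ℕ.iterate f (f x) j ])
      ≡⟨ cong reverse (sym (iterate-++ f (f x) j)) ⟩
    reverse (iterate f (f x) (suc j))
      ∎
    where
    open ≡-Reasoning
    g∘f-step : g (ℕ.iterate f x (suc j)) ≡ ℕ.iterate f x j
    g∘f-step = trans (cong g (iterate-suc f x j)) (σ∘π (iterate-range j x∈))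

  module _ (cyclic-π : Unique (cycleForm N π)) where

    orbit-↭ : cycleForm N π ↭ oneTo N
    orbit-↭ = ⊆-length⇒↭ cyclic-π (oneTo-unique N) (∈-oneTo⁺ ∘ orbit-range 1∈)
      (≤-reflexive (trans (List.length-applyUpTo suc N) (sym (List.length-iterate f 1 N))))

    -- The orbit of 1 is all of [1, N], so σ(1) = πʲ(1) for some j < N, and j < m would
    -- make 1 = πʲ⁺¹(1) reappear in the orbit.
    σ1≡last : g 1 ≡ ℕ.iterate f 1 m
    σ1≡last
      with j , j<N , g1≡f^j1 ← ∈-iterate⁻ N (∈-resp-↭ (↭-sym orbit-↭) (∈-oneTo⁺ (σ-range 1∈))) =
      subst (λ i → g 1 ≡ ℕ.iterate f 1 i) (≤-antisym (≤-pred j<N) (≮⇒≥ j≮m)) g1≡f^j1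
      where
      1≡f^j+1 : 1 ≡ ℕ.iterate f 1 (suc j)
      1≡f^j+1 = trans (sym (π∘σ 1∈)) (trans (cong f g1≡f^j1) (sym (iterate-suc f 1 j)))
      j≮m : ¬ j < m
      j≮m j<m = All.lookup (AllPairs.head cyclic-π) (∈-iterate⁺ j<m) 1≡f^j+1

    cycleForm-inverse : cycleForm N σ ≡ 1 ∷ reverse (iterate f (f 1) m)
    cycleForm-inverse = cong (1 ∷_) (trans (cong (λ y → iterate g y m) σ1≡last) (iterate-inverse m 1∈))

    inverse-cyclic : Unique (cycleForm N σ)
    inverse-cyclic = subst Unique (sym cycleForm-inverse)
      (Unique-resp-↭ (prep 1 (↭-sym (↭-reverse (iterate f (f 1) m)))) cyclic-π)

    cycle-tail-≥1 : All (1 ≤_) (iterate f (f 1) m)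
    cycle-tail-≥1 = All.tabulate (proj₁ ∘ orbit-range 1∈ ∘ there)

cyclic-inverse : ∀ {m π σ} → Inverses (suc m) π σ → cyclic (suc m) σ ≡ cyclic (suc m) π
cyclic-inverse inv = T-ext
  (Unique⇒distinctᵇ ∘ Cycle.inverse-cyclic (Inverses-sym inv) ∘ distinctᵇ⇒Unique _)
  (Unique⇒distinctᵇ ∘ Cycle.inverse-cyclic inv ∘ distinctᵇ⇒Unique _)

Contains : List ℕ → List ℕ → Set
Contains τ w = ∃[ u ] u ⊆ w × T (orderIso u τ)

∈-subseqs⁻ : ∀ w {u} → u ∈ subseqs w → u ⊆ w
∈-subseqs⁻ []       (here refl) = []
∈-subseqs⁻ (x ∷ xs) u∈ with ∈-++⁻ (map (x ∷_) (subseqs xs)) u∈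
... | inj₁ u∈ˡ with u′ , u′∈ , refl ← ∈-map⁻ (x ∷_) u∈ˡ = refl ∷ ∈-subseqs⁻ xs u′∈
... | inj₂ u∈ʳ = x ∷ʳ ∈-subseqs⁻ xs u∈ʳ

∈-subseqs⁺ : ∀ {u w} → u ⊆ w → u ∈ subseqs w
∈-subseqs⁺ []                        = here refl
∈-subseqs⁺ (_∷ʳ_ {ys = ys} y u⊆w)    = ∈-++⁺ʳ (map (y ∷_) (subseqs ys)) (∈-subseqs⁺ u⊆w)
∈-subseqs⁺ (refl ∷ u⊆w)              = ∈-++⁺ˡ (∈-map⁺ _ (∈-subseqs⁺ u⊆w))

contains⁻ : ∀ {τ w} → T (contains τ w) → Contains τ w
contains⁻ {τ} {w} h with u , u∈ , iso ← find (any⁻ (λ u → orderIso u τ) (subseqs w) h) =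
  u , ∈-subseqs⁻ w u∈ , iso

contains⁺ : ∀ {τ w} → Contains τ w → T (contains τ w)
contains⁺ {τ} (u , u⊆w , iso) = any⁺ (λ u → orderIso u τ) (lose (∈-subseqs⁺ u⊆w) iso)

contains-≡ : ∀ {τ w τ′ w′} →
  (Contains τ w → Contains τ′ w′) → (Contains τ′ w′ → Contains τ w) → contains τ w ≡ contains τ′ w′
contains-≡ forth back = T-ext (contains⁺ ∘ forth ∘ contains⁻) (contains⁺ ∘ back ∘ contains⁻)

orderIso-length : ∀ u τ → T (orderIso u τ) → length u ≡ length τ
orderIso-length []      []      _   = refl
orderIso-length (x ∷ u) (s ∷ τ) iso = cong suc (orderIso-length u τ (proj₂ (to T-∧ iso)))

-- The test orderIso applies to entries x, y of the word against entries s, t of the pattern.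
agreeᵇ : ℕ → ℕ → ℕ → ℕ → Bool
agreeᵇ x s y t = ((x <ᵇ y) ==ᵇ (s <ᵇ t)) ∧ ((y <ᵇ x) ==ᵇ (t <ᵇ s))

agreeᵇ-sym : ∀ x s y t → agreeᵇ x s y t ≡ agreeᵇ y t x s
agreeᵇ-sym x s y t = ∧-comm ((x <ᵇ y) ==ᵇ (s <ᵇ t)) ((y <ᵇ x) ==ᵇ (t <ᵇ s))

orderIso-reverse₃ : ∀ a b c s₁ s₂ s₃ →
  orderIso (c ∷ b ∷ a ∷ []) (s₃ ∷ s₂ ∷ s₁ ∷ [])
    ≡ orderIso (a ∷ b ∷ c ∷ []) (s₁ ∷ s₂ ∷ s₃ ∷ [])
orderIso-reverse₃ a b c s₁ s₂ s₃ =
  rotate (agreeᵇ-sym b s₂ a s₁) (agreeᵇ-sym c s₃ a s₁) (agreeᵇ-sym c s₃ b s₂)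
  where
  rotate : ∀ {p q r p′ q′ r′} → p′ ≡ p → q′ ≡ q → r′ ≡ r →
    (r′ ∧ q′ ∧ true) ∧ (p′ ∧ true) ∧ true ≡ (p ∧ q ∧ true) ∧ (r ∧ true) ∧ true
  rotate {true}  {true}  {true}  refl refl refl = refl
  rotate {true}  {true}  {false} refl refl refl = refl
  rotate {true}  {false} {true}  refl refl refl = refl
  rotate {true}  {false} {false} refl refl refl = refl
  rotate {false} {true}  {true}  refl refl refl = refl
  rotate {false} {true}  {false} refl refl refl = refl
  rotate {false} {false} {true}  refl refl refl = refl
  rotate {false} {false} {false} refl refl refl = refl

Contains-reverse₃ : ∀ {s₁ s₂ s₃ w} →
  Contains (s₁ ∷ s₂ ∷ s₃ ∷ []) w → Contains (s₃ ∷ s₂ ∷ s₁ ∷ []) (reverse w)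
Contains-reverse₃ (u , u⊆w , iso) = reverse-occurrence u u⊆w iso (orderIso-length u _ iso)
  where
  reverse-occurrence : ∀ {s₁ s₂ s₃ w} u → u ⊆ w → T (orderIso u (s₁ ∷ s₂ ∷ s₃ ∷ [])) →
    length u ≡ 3 → Contains (s₃ ∷ s₂ ∷ s₁ ∷ []) (reverse w)
  reverse-occurrence {s₁} {s₂} {s₃} (a ∷ b ∷ c ∷ []) u⊆w iso refl =
    c ∷ b ∷ a ∷ [] , Sublist.reverse⁺ u⊆w , subst T (sym (orderIso-reverse₃ a b c s₁ s₂ s₃)) iso

contains-reverse₃ : ∀ s₁ s₂ s₃ w →
  contains (s₃ ∷ s₂ ∷ s₁ ∷ []) (reverse w) ≡ contains (s₁ ∷ s₂ ∷ s₃ ∷ []) w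
contains-reverse₃ s₁ s₂ s₃ w =
  contains-≡ (subst (Contains _) (List.reverse-involutive w) ∘ Contains-reverse₃) Contains-reverse₃

<ᵇ-true : ∀ {m n} → m < n → (m <ᵇ n) ≡ true
<ᵇ-true {m} {n} m<n with m <ᵇ n | <⇒<ᵇ m<n
... | true | _ = refl

<ᵇ-false : ∀ {m n} → ¬ m < n → (m <ᵇ n) ≡ false
<ᵇ-false {m} {n} m≮n with m <ᵇ n | <ᵇ-reflects-< m n
... | true  | ofʸ m<n = ⊥-elim (m≮n m<n)
... | false | _       = refl

orderIso-∷-minimum : ∀ {x y s t} u τ → x ≤ y → t < s → ¬ T (orderIso (x ∷ y ∷ u) (s ∷ t ∷ τ))
orderIso-∷-minimum {x} {y} {s} {t} u τ x≤y t<s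
  rewrite <ᵇ-false (≤⇒≯ x≤y) | <ᵇ-true t<s | ∧-zeroʳ ((x <ᵇ y) ==ᵇ (s <ᵇ t)) = λ ()

contains-∷-minimum : ∀ {x w s t τ} → All (x ≤_) w → t < s →
  contains (s ∷ t ∷ τ) (x ∷ w) ≡ contains (s ∷ t ∷ τ) w
contains-∷-minimum {x} {w} {s} {t} {τ} x≤w t<s =
  contains-≡ drop-x (λ (u , u⊆w , iso) → u , x ∷ʳ u⊆w , iso)
  where
  drop-x : Contains (s ∷ t ∷ τ) (x ∷ w) → Contains (s ∷ t ∷ τ) w
  drop-x (u          , _ ∷ʳ u⊆w          , iso) = u , u⊆w , iso
  drop-x (x ∷ y ∷ u , refl ∷ y∷u⊆w , iso) =
    ⊥-elim (orderIso-∷-minimum u τ (All.lookup x≤w (Sublist.Any-resp-⊆ y∷u⊆w (here refl))) t<s iso)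

length-δ : ∀ k → length (δ k) ≡ k
length-δ zero    = refl
length-δ (suc k) = cong suc (length-δ k)

δ-below : ∀ k → All (_< suc k) (δ k)
δ-below zero    = []
δ-below (suc k) = n<1+n (suc k) ∷ All.map m<n⇒m<1+n (δ-below k)

agreeᵇ-below : ∀ {x y s t} → t < s → T (agreeᵇ x s y t) ⇔ y < x
agreeᵇ-below {x} {y} {s} {t} t<s rewrite <ᵇ-false (<⇒≯ t<s) | <ᵇ-true t<s
  with x <ᵇ y | <ᵇ-reflects-< x y | y <ᵇ x | <ᵇ-reflects-< y x
... | true  | ofʸ x<y | true  | ofʸ y<x = ⊥-elim (<-asym x<y y<x)
... | false | _       | true  | ofʸ y<x = mk⇔ (λ _ → y<x) (λ _ → _)
... | true  | _       | false | ofⁿ y≮x = mk⇔ (λ ()) (⊥-elim ∘ y≮x)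
... | false | _       | false | ofⁿ y≮x = mk⇔ (λ ()) (⊥-elim ∘ y≮x)

below-head⁻ : ∀ {x s} u ts → length u ≡ length ts → All (_< s) ts →
  T (and (zipWith (agreeᵇ x s) u ts)) → All (_< x) u
below-head⁻ []      []       _   _            _   = []
below-head⁻ (y ∷ u) (t ∷ ts) len (t<s ∷ ts<s) row =
  to (agreeᵇ-below t<s) (proj₁ (to T-∧ row))
    ∷ below-head⁻ u ts (suc-injective len) ts<s (proj₂ (to T-∧ row))

below-head⁺ : ∀ {x s} u ts → All (_< s) ts → All (_< x) u → T (and (zipWith (agreeᵇ x s) u ts))
below-head⁺ []      _        _            _           = _
below-head⁺ (y ∷ u) []       _            _           = _
below-head⁺ (y ∷ u) (t ∷ ts) (t<s ∷ ts<s) (y<x ∷ u<x) =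
  from T-∧ (from (agreeᵇ-below t<s) y<x , below-head⁺ u ts ts<s u<x)

orderIso-δ⁻ : ∀ u k → T (orderIso u (δ k)) → Decreasing u
orderIso-δ⁻ []      _       _   = []
orderIso-δ⁻ (x ∷ u) (suc k) iso =
  below-head⁻ u (δ k) (orderIso-length u (δ k) rest) (δ-below k) row ∷ orderIso-δ⁻ u k rest
  where
  row  = proj₁ (to T-∧ iso)
  rest = proj₂ (to T-∧ iso)

orderIso-δ⁺ : ∀ u k → length u ≡ k → Decreasing u → T (orderIso u (δ k))
orderIso-δ⁺ []      zero    _   _           = _
orderIso-δ⁺ (x ∷ u) (suc k) len (u<x ∷ dec) =
  from T-∧ (below-head⁺ u (δ k) (δ-below k) u<x , orderIso-δ⁺ u k (suc-injective len) dec)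

⊆-map⁻ : ∀ {A B : Set} (f : A → B) {u} L → u ⊆ map f L → ∃[ I ] I ⊆ L × u ≡ map f I
⊆-map⁻ f []      []            = [] , [] , refl
⊆-map⁻ f (l ∷ L) (_ ∷ʳ u⊆fL)
  with I , I⊆L , refl ← ⊆-map⁻ f L u⊆fL = I , l ∷ʳ I⊆L , refl
⊆-map⁻ f (l ∷ L) (refl ∷ u⊆fL)
  with I , I⊆L , refl ← ⊆-map⁻ f L u⊆fL = l ∷ I , refl ∷ I⊆L , refl

AllPairs-resp-⊆ : ∀ {A : Set} {R : A → A → Set} {xs ys} → xs ⊆ ys → AllPairs R ys → AllPairs R xs
AllPairs-resp-⊆ []           []       = []
AllPairs-resp-⊆ (_ ∷ʳ xs⊆ys) (_ ∷ ap) = AllPairs-resp-⊆ xs⊆ys ap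
AllPairs-resp-⊆ (refl ∷ xs⊆ys) (r ∷ ap) = Sublist.All-resp-⊆ xs⊆ys r ∷ AllPairs-resp-⊆ xs⊆ys ap

AllPairs-reverse : ∀ {A : Set} {R : A → A → Set} {xs} → AllPairs R xs → AllPairs (flip R) (reverse xs)
AllPairs-reverse {xs = []}     []       = []
AllPairs-reverse {xs = x ∷ xs} (r ∷ ap) rewrite List.unfold-reverse x xs =
  AllPairs.++⁺ (AllPairs-reverse ap) ([] ∷ []) (All-resp-↭ (↭-sym (↭-reverse xs)) (All.map (_∷ []) r))

increasing-⊆ : ∀ {I L} → Increasing I → Increasing L → All (_∈ L) I → I ⊆ L
increasing-⊆ {[]}    {L}     _            _            _                 = minimum L
increasing-⊆ {i ∷ I} {l ∷ L} (i<I ∷ incI) (l<L ∷ incL) (here refl ∷ I∈) =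
  refl ∷ increasing-⊆ incI incL (All.zipWith (λ (i<j , j∈) → ∈-∷⁻ j∈ (<⇒≢ i<j)) (i<I , I∈))
increasing-⊆ {i ∷ I} {l ∷ L} (i<I ∷ incI) (l<L ∷ incL) (there i∈L ∷ I∈) =
  l ∷ʳ increasing-⊆ (i<I ∷ incI) incL
    (i∈L ∷ All.zipWith (λ (i<j , j∈) → ∈-∷⁻ j∈ (<⇒≢ (<-trans l<i i<j))) (i<I , I∈))
  where l<i = All.lookup l<L i∈L

map-app-oneTo : ∀ w → map (app w) (oneTo (length w)) ≡ w
map-app-oneTo w = trans (List.map-applyUpTo suc (app w) (length w)) (applyUpTo-app w)

DecreasingSubsequence : ℕ → List ℕ → ℕ → Set
DecreasingSubsequence n w k = ∃[ I ] I ⊆ oneTo n × length I ≡ k × Decreasing (map (app w) I)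

contains-δ⁻ : ∀ {k w} → T (contains (δ k) w) → DecreasingSubsequence (length w) w k
contains-δ⁻ {k} {w} h with u , u⊆w , iso ← contains⁻ h
  with I , I⊆ , refl ← ⊆-map⁻ (app w) (oneTo (length w)) (subst (u ⊆_) (sym (map-app-oneTo w)) u⊆w) =
  I , I⊆ ,
  trans (sym (List.length-map (app w) I)) (trans (orderIso-length (map (app w) I) (δ k) iso) (length-δ k)) ,
  orderIso-δ⁻ _ k iso

contains-δ⁺ : ∀ {k w} → DecreasingSubsequence (length w) w k → T (contains (δ k) w)
contains-δ⁺ {k} {w} (I , I⊆ , len , dec) = contains⁺
  ( map (app w) I
  , subst (map (app w) I ⊆_) (map-app-oneTo w) (Sublist.map⁺ (app w) I⊆)
  , orderIso-δ⁺ _ k (trans (List.length-map (app w) I) len) dec )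

-- Positions and values trade places: the new positions are π(I), read backwards.
DecreasingSubsequence-inverse : ∀ {n π σ k} → Inverses n π σ →
  DecreasingSubsequence n π k → DecreasingSubsequence n σ k
DecreasingSubsequence-inverse {n} {π} {σ} inv (I , I⊆ , len , dec) =
  J , increasing-⊆ (AllPairs-reverse dec) (oneTo-increasing n) J∈ ,
  trans (List.length-reverse (map (app π) I)) (trans (List.length-map (app π) I) len) ,
  subst Decreasing (sym σJ≡reverseI) (AllPairs-reverse (AllPairs-resp-⊆ I⊆ (oneTo-increasing n)))
  where
  open Inverses inv
  J = reverse (map (app π) I)
  I∈ : All (InRange n) I
  I∈ = Sublist.All-resp-⊆ I⊆ (All.tabulate ∈-oneTo⁻)
  J∈ : All (_∈ oneTo n) J
  J∈ = All-resp-↭ (↭-sym (↭-reverse _)) (All.map⁺ (All.map (∈-oneTo⁺ ∘ π-range) I∈))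
  σJ≡reverseI : map (app σ) J ≡ reverse I
  σJ≡reverseI = begin
    map (app σ) (reverse (map (app π) I))   ≡⟨ List.reverse-map (app σ) (map (app π) I) ⟩
    reverse (map (app σ) (map (app π) I))   ≡⟨ cong reverse (sym (List.map-∘ I)) ⟩
    reverse (map (app σ ∘ app π) I)         ≡⟨ cong reverse (List.map-id-local (All.map σ∘π I∈)) ⟩
    reverse I                               ∎
    where open ≡-Reasoning

contains-δ⇒inverse : ∀ {n π σ k} → Inverses n π σ → length π ≡ n → length σ ≡ n →
  T (contains (δ k) π) → T (contains (δ k) σ)
contains-δ⇒inverse {π = π} {σ} {k} inv refl σ-length =
  contains-δ⁺ {k} {σ} ∘ subst (λ m → DecreasingSubsequence m σ k) (sym σ-length)
  ∘ DecreasingSubsequence-inverse inv ∘ contains-δ⁻ {k} {π}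

contains-δ-inverse : ∀ {n π σ} k → Inverses n π σ → length π ≡ n → length σ ≡ n →
  contains (δ k) σ ≡ contains (δ k) π
contains-δ-inverse k inv π-length σ-length =
  T-ext (contains-δ⇒inverse (Inverses-sym inv) σ-length π-length)
        (contains-δ⇒inverse inv π-length σ-length)

cyclicAvoiding : ℕ → ℕ → List ℕ → List ℕ → Bool
cyclicAvoiding n k τ π = cyclic n π ∧ avoids (δ k) π ∧ avoids τ (cycleForm n π)

contains-213-inverse : ∀ {m π σ} → Inverses (suc m) π σ → Unique (cycleForm (suc m) π) →
  contains (2 ∷ 1 ∷ 3 ∷ []) (cycleForm (suc m) σ) ≡ contains (3 ∷ 1 ∷ 2 ∷ []) (cycleForm (suc m) π)
contains-213-inverse {m} {π} {σ} inv cyclic-π = begin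
  contains (2 ∷ 1 ∷ 3 ∷ []) (cycleForm (suc m) σ) ≡⟨ cong (contains _) (cycleForm-inverse cyclic-π) ⟩
  contains (2 ∷ 1 ∷ 3 ∷ []) (1 ∷ reverse t)       ≡⟨ contains-∷-minimum reverse-t≥1 1<2 ⟩
  contains (2 ∷ 1 ∷ 3 ∷ []) (reverse t)           ≡⟨ contains-reverse₃ 3 1 2 t ⟩
  contains (3 ∷ 1 ∷ 2 ∷ []) t                     ≡⟨ sym (contains-∷-minimum t≥1 1<3) ⟩
  contains (3 ∷ 1 ∷ 2 ∷ []) (1 ∷ t)               ∎
  where
  open ≡-Reasoning
  open Cycle inv
  t = iterate (app π) (app π 1) m
  t≥1 = cycle-tail-≥1 cyclic-π
  reverse-t≥1 = All-resp-↭ (↭-sym (↭-reverse t)) t≥1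
  1<2 = s≤s (s≤s z≤n)
  1<3 = s≤s (s≤s z≤n)

cyclicAvoiding-inverse : ∀ m k {π} → π ∈ Sym (suc m) →
  cyclicAvoiding (suc m) k (3 ∷ 1 ∷ 2 ∷ []) π
    ≡ cyclicAvoiding (suc m) k (2 ∷ 1 ∷ 3 ∷ []) (inverse (suc m) π)
cyclicAvoiding-inverse m k {π} π∈ = begin
  cyclic N π ∧ avoids (δ k) π ∧ avoids (3 ∷ 1 ∷ 2 ∷ []) (cycleForm N π)
    ≡⟨ ∧-congˡ-T (λ cyc → cong₂ (λ b c → not b ∧ not c)
         (sym (contains-δ-inverse k inv π-length σ-length))
         (sym (contains-213-inverse inv (distinctᵇ⇒Unique _ cyc)))) ⟩
  cyclic N π ∧ avoids (δ k) σ ∧ avoids (2 ∷ 1 ∷ 3 ∷ []) (cycleForm N σ)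
    ≡⟨ cong (_∧ avoids (δ k) σ ∧ avoids (2 ∷ 1 ∷ 3 ∷ []) (cycleForm N σ))
         (sym (cyclic-inverse inv)) ⟩
  cyclic N σ ∧ avoids (δ k) σ ∧ avoids (2 ∷ 1 ∷ 3 ∷ []) (cycleForm N σ)
    ∎
  where
  open ≡-Reasoning
  N = suc m
  σ = inverse N π
  π↭ = ∈-Sym⁻ N π∈
  inv = Permutation.inverses π↭
  π-length = Permutation.length-π π↭
  σ-length = Permutation.length-π (Permutation.inverse-↭ π↭)

theorem2p10 : (n k : ℕ) → 1 ≤ n → 1 ≤ k →
    a n k (3 ∷ 1 ∷ 2 ∷ []) ≡ a n k (2 ∷ 1 ∷ 3 ∷ [])
theorem2p10 (suc m) k _ _ =
  length-filterᵇ-bijection (inverse (suc m)) {p = cyclicAvoiding (suc m) k (3 ∷ 1 ∷ 2 ∷ [])}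
    (map-inverse-Sym (suc m)) (cyclicAvoiding-inverse m k)
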